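{- Let $A\in\mathsf{Form}$. If $A$ is a theorem of the Hilbert system $(\mathbf{C+J})^{ - }$, then $A$ is 3-valid.
   Context: $\mathsf{Form}$ is the set of formulas built from a countably infinite set $\mathsf{Prop}$ of propositional variables by $A ::= p \mid \bot \mid A \lor A \mid A \land A \mid A \to_{\mathtt{i}} A \mid A \to_{\mathtt{c}} A$; $\mathsf{Form}_{\mathbf{C}}$ is the set of formulas not containing $\to_{\mathtt{i}}$. Persistent formulas are given by $E ::= \bot \mid p \mid A \to_{\mathtt{i}} A \mid E \land E \mid E \lor E$ ($p\in\mathsf{Prop}$, $A\in\mathsf{Form}$). The Hilbert system $(\mathbf{C+J})^{ - }$ has axioms: (CL) all substitution instances $\sigma(A')$ (with $\sigma:\mathsf{Prop}\to\mathsf{Form}$ a uniform substitution) of classical tautologies $A'\in\mathsf{Form}_{\mathbf{C}}$ (two-valued, $\bot$ false, $\to_{\mathtt{c}}$ material implication); (CK) $(A \to_{\mathtt{i}} (B \to_{\mathtt{c}} C)) \to_{\mathtt{c}} ((A \to_{\mathtt{i}} B) \to_{\mathtt{c}} (A \to_{\mathtt{i}} C))$; (ID) $A \to_{\mathtt{i}} A$; (CMP) $(A \to_{\mathtt{i}} B) \to_{\mathtt{c}} (A \to_{\mathtt{c}} B)$; (PER) $A \to_{\mathtt{c}} (B \to_{\mathtt{i}} A)$ for persistent $A$; and exactly two rules: (MPI) from $A$ and $A \to_{\mathtt{i}} B$ infer $B$; (RCN) from $A$ infer $B \to_{\mathtt{i}} A$. A three-valued valuation $v:\mathsf{Prop}\to\{\{0\},\{0,1\},\{1\}\}$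 extends uniquely to $\overline{v}$ on all formulas by: $\overline v(p)=v(p)$; $1\notin\overline v(\bot)$, $0\in\overline v(\bot)$; $1\in\overline v(A\land B)$ iff $1\in\overline v(A)$ and $1\in \overline v(B)$; $0\in\overline v(A\land B)$ iff $0\in\overline v(A)$ or $0\in\overline v(B)$; $1\in\overline v(A\lor B)$ iff $1\in\overline v(A)$ or $1\in\overline v(B)$; $0\in\overline v(A\lor B)$ iff $0\in\overline v(A)$ and $0\in\overline v(B)$; $1\in\overline v(A\to_{\mathtt{c}}B)$ iff $0\in\overline v(A)$ or $1\in\overline v(B)$; $0\in\overline v(A\to_{\mathtt{c}}B)$ iff $1\in\overline v(A)$ and $0\in\overline v(B)$; $1\in\overline v(A\to_{\mathtt{i}}B)$ iff $1\notin\overline v(A)$ or $1\in\overline v(B)$; $0\in\overline v(A\to_{\mathtt{i}}B)$ iff $1\in\overline v(A)$ and $0\in\overline v(B)$. A formula $A$ is 3-valid if $1\in\overline v(A)$ for every three-valued valuation $v$. -}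

module Defs where

open import Data.Nat using (ℕ)
open import Data.Bool using (Bool; true; false; _∧_; _∨_; not; T)
open import Data.Product using (_×_; _,_; proj₁; proj₂)
open import Data.Unit using (⊤)
open import Data.Empty using (⊥)

infixr 5 _→i_ _→c_
infixr 6 _∨f_
infixr 7 _∧f_

data Form : Set where
  var  : ℕ → Form
  ⊥f   : Form
  _∨f_ : Form → Form → Form
  _∧f_ : Form → Form → Form
  _→i_ : Form → Form → Form
  _→c_ : Form → Form → Form

IsClassical : Form → Set
IsClassical (var p)  = ⊤
IsClassical ⊥f       = ⊤
IsClassical (A ∨f B) = IsClassical A × IsClassical B
IsClassical (A ∧f B) = IsClassical A × IsClassical B
IsClassical (A →i B) = ⊥
IsClassical (A →c B) = IsClassical A × IsClassical B

-- Two-valued evaluation of formulas of Form_C (the →i clause is never used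
-- for formulas in Form_C; we give it an arbitrary value).
eval2 : (ℕ → Bool) → Form → Bool
eval2 w (var p)  = w p
eval2 w ⊥f       = false
eval2 w (A ∨f B) = eval2 w A ∨ eval2 w B
eval2 w (A ∧f B) = eval2 w A ∧ eval2 w B
eval2 w (A →i B) = false
eval2 w (A →c B) = not (eval2 w A) ∨ eval2 w B

Tautology : Form → Set
Tautology A = IsClassical A × ((w : ℕ → Bool) → T (eval2 w A))

subst : (ℕ → Form) → Form → Form
subst σ (var p)  = σ p
subst σ ⊥f       = ⊥f
subst σ (A ∨f B) = subst σ A ∨f subst σ B
subst σ (A ∧f B) = subst σ A ∧f subst σ B
subst σ (A →i B) = subst σ A →i subst σ B
subst σ (A →c B) = subst σ A →c subst σ B

data Persistent : Form → Set where
  per-⊥   : Persistent ⊥f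
  per-var : ∀ p → Persistent (var p)
  per-→i  : ∀ A B → Persistent (A →i B)
  per-∧   : ∀ {E F} → Persistent E → Persistent F → Persistent (E ∧f F)
  per-∨   : ∀ {E F} → Persistent E → Persistent F → Persistent (E ∨f F)

data Thm : Form → Set where
  CL   : ∀ (σ : ℕ → Form) (A' : Form) → Tautology A' → Thm (subst σ A')
  CK   : ∀ A B C → Thm ((A →i (B →c C)) →c ((A →i B) →c (A →i C)))
  ID   : ∀ A → Thm (A →i A)
  CMP  : ∀ A B → Thm ((A →i B) →c (A →c B))
  PER  : ∀ A B → Persistent A → Thm (A →c (B →i A))
  MPI  : ∀ {A B} → Thm A → Thm (A →i B) → Thm B
  RCN  : ∀ {A} B → Thm A → Thm (B →i A)

-- Three truth values {0}, {0,1}, {1}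
data V3 : Set where
  v0 v01 v1 : V3

has1 : V3 → Bool
has1 v0  = false
has1 v01 = true
has1 v1  = true

has0 : V3 → Bool
has0 v0  = true
has0 v01 = true
has0 v1  = false

-- extended valuation: returns (1 ∈ v̄(A) , 0 ∈ v̄(A))
ev3 : (ℕ → V3) → Form → Bool × Bool
ev3 v (var p)  = has1 (v p) , has0 (v p)
ev3 v ⊥f       = false , true
ev3 v (A ∨f B) = (proj₁ (ev3 v A) ∨ proj₁ (ev3 v B)) , (proj₂ (ev3 v A) ∧ proj₂ (ev3 v B))
ev3 v (A ∧f B) = (proj₁ (ev3 v A) ∧ proj₁ (ev3 v B)) , (proj₂ (ev3 v A) ∨ proj₂ (ev3 v B))
ev3 v (A →c B) = (proj₂ (ev3 v A) ∨ proj₁ (ev3 v B)) , (proj₁ (ev3 v A) ∧ proj₂ (ev3 v B))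
ev3 v (A →i B) = (not (proj₁ (ev3 v A)) ∨ proj₁ (ev3 v B)) , (proj₁ (ev3 v A) ∧ proj₂ (ev3 v B))

One∈ : (ℕ → V3) → Form → Set
One∈ v A = T (proj₁ (ev3 v A))

Valid3 : Form → Set
Valid3 A = (v : ℕ → V3) → One∈ v A

{-# OPTIONS --safe #-}
-- A formula's three-valued value is a pair (1 ∈ v̄ A , 0 ∈ v̄ A), and every such
-- pair is nonempty. On →i-free formulas the connectives are monotone when both
-- components may only grow, and a nonempty pair lies above the bivalent pair
-- with the same first component; so a substitution instance of a tautology is
-- designated because the classical valuation read off the first components
-- already makes it true.
module Submission where

open import Defs
open import Data.Nat using (ℕ)
open import Data.Bool using (Bool; true; false; _∧_; _∨_; not; T; _≤_; b≤b; f≤t)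
open import Data.Bool.Properties using (≤-minimum; ≤-maximum)
open import Data.Product using (_×_; _,_; proj₁; proj₂)
open import Data.Unit using (tt)
open import Function using (_∘_)
open import Relation.Binary.PropositionalEquality using (_≡_; refl; cong₂; trans)

-- A value is the pair (1 ∈ x , 0 ∈ x) as in ev3, whose clauses are the operations
-- below up to unfolding.
Val : Set
Val = Bool × Bool

Designated : Val → Set
Designated = T ∘ proj₁

⊥v : Val
⊥v = false , true

¬v : Val → Val
¬v (a₁ , a₀) = a₀ , a₁

infixr 6 _∨v_
infixr 7 _∧v_
infixr 5 _⇒c_ _⇒i_

_∨v_ _∧v_ _⇒c_ _⇒i_ : Val → Val → Val
(a₁ , a₀) ∨v (b₁ , b₀) = a₁ ∨ b₁ , a₀ ∧ b₀
(a₁ , a₀) ∧v (b₁ , b₀) = a₁ ∧ b₁ , a₀ ∨ b₀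
a ⇒c b = ¬v a ∨v b
(a₁ , a₀) ⇒i (b₁ , b₀) = not a₁ ∨ b₁ , a₁ ∧ b₀

⟦_⟧ : Form → (ℕ → Val) → Val
⟦ var p  ⟧ u = u p
⟦ ⊥f     ⟧ u = ⊥v
⟦ A ∨f B ⟧ u = ⟦ A ⟧ u ∨v ⟦ B ⟧ u
⟦ A ∧f B ⟧ u = ⟦ A ⟧ u ∧v ⟦ B ⟧ u
⟦ A →c B ⟧ u = ⟦ A ⟧ u ⇒c ⟦ B ⟧ u
⟦ A →i B ⟧ u = ⟦ A ⟧ u ⇒i ⟦ B ⟧ u

ev3-subst : ∀ v σ A → ev3 v (subst σ A) ≡ ⟦ A ⟧ (ev3 v ∘ σ)
ev3-subst v σ (var p)  = refl
ev3-subst v σ ⊥f       = refl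
ev3-subst v σ (A ∨f B) = cong₂ _∨v_ (ev3-subst v σ A) (ev3-subst v σ B)
ev3-subst v σ (A ∧f B) = cong₂ _∧v_ (ev3-subst v σ A) (ev3-subst v σ B)
ev3-subst v σ (A →c B) = cong₂ _⇒c_ (ev3-subst v σ A) (ev3-subst v σ B)
ev3-subst v σ (A →i B) = cong₂ _⇒i_ (ev3-subst v σ A) (ev3-subst v σ B)

data NonEmpty : Val → Set where
  only0 : NonEmpty (false , true)
  both  : NonEmpty (true , true)
  only1 : NonEmpty (true , false)

code-nonEmpty : ∀ t → NonEmpty (has1 t , has0 t)
code-nonEmpty v0  = only0
code-nonEmpty v01 = both
code-nonEmpty v1  = only1

¬v-nonEmpty : ∀ {a} → NonEmpty a → NonEmpty (¬v a)
¬v-nonEmpty only0 = only1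
¬v-nonEmpty both  = both
¬v-nonEmpty only1 = only0

∨v-nonEmpty : ∀ {a b} → NonEmpty a → NonEmpty b → NonEmpty (a ∨v b)
∨v-nonEmpty only0 nb    = nb
∨v-nonEmpty both  only0 = both
∨v-nonEmpty both  both  = both
∨v-nonEmpty both  only1 = only1
∨v-nonEmpty only1 _     = only1

∧v-nonEmpty : ∀ {a b} → NonEmpty a → NonEmpty b → NonEmpty (a ∧v b)
∧v-nonEmpty only0 _     = only0
∧v-nonEmpty both  only0 = only0
∧v-nonEmpty both  both  = both
∧v-nonEmpty both  only1 = both
∧v-nonEmpty only1 nb    = nb

⇒i-nonEmpty : ∀ a {b} → NonEmpty b → NonEmpty (a ⇒i b)
⇒i-nonEmpty (false , _) _  = only1
⇒i-nonEmpty (true  , _) nb = nb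

ev3-nonEmpty : ∀ v A → NonEmpty (ev3 v A)
ev3-nonEmpty v (var p)  = code-nonEmpty (v p)
ev3-nonEmpty v ⊥f       = only0
ev3-nonEmpty v (A ∨f B) = ∨v-nonEmpty (ev3-nonEmpty v A) (ev3-nonEmpty v B)
ev3-nonEmpty v (A ∧f B) = ∧v-nonEmpty (ev3-nonEmpty v A) (ev3-nonEmpty v B)
ev3-nonEmpty v (A →c B) = ∨v-nonEmpty (¬v-nonEmpty (ev3-nonEmpty v A)) (ev3-nonEmpty v B)
ev3-nonEmpty v (A →i B) = ⇒i-nonEmpty (ev3 v A) (ev3-nonEmpty v B)

∨-mono-≤ : ∀ {a b c d} → a ≤ b → c ≤ d → a ∨ c ≤ b ∨ d
∨-mono-≤ f≤t _ = ≤-maximum _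
∨-mono-≤ {true}  b≤b _   = b≤b
∨-mono-≤ {false} b≤b c≤d = c≤d

∧-mono-≤ : ∀ {a b c d} → a ≤ b → c ≤ d → a ∧ c ≤ b ∧ d
∧-mono-≤ f≤t _ = ≤-minimum _
∧-mono-≤ {true}  b≤b c≤d = c≤d
∧-mono-≤ {false} b≤b _   = b≤b

T-mono-≤ : ∀ {a b} → a ≤ b → T a → T b
T-mono-≤ b≤b t = t

infix 4 _⊑_

_⊑_ : Val → Val → Set
(a₁ , a₀) ⊑ (b₁ , b₀) = a₁ ≤ b₁ × a₀ ≤ b₀

⊑-refl : ∀ {a} → a ⊑ a
⊑-refl = b≤b , b≤b

⟦⟧-mono : ∀ {u u′} A → IsClassical A → (∀ p → u p ⊑ u′ p) → ⟦ A ⟧ u ⊑ ⟦ A ⟧ u′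
⟦⟧-mono (var p)  _         u⊑u′ = u⊑u′ p
⟦⟧-mono ⊥f       _         _    = ⊑-refl
⟦⟧-mono (A ∨f B) (cA , cB) u⊑u′
  with (a₁ , a₀) ← ⟦⟧-mono A cA u⊑u′ | (b₁ , b₀) ← ⟦⟧-mono B cB u⊑u′
  = ∨-mono-≤ a₁ b₁ , ∧-mono-≤ a₀ b₀
⟦⟧-mono (A ∧f B) (cA , cB) u⊑u′
  with (a₁ , a₀) ← ⟦⟧-mono A cA u⊑u′ | (b₁ , b₀) ← ⟦⟧-mono B cB u⊑u′
  = ∧-mono-≤ a₁ b₁ , ∨-mono-≤ a₀ b₀
⟦⟧-mono (A →c B) (cA , cB) u⊑u′
  with (a₁ , a₀) ← ⟦⟧-mono A cA u⊑u′ | (b₁ , b₀) ← ⟦⟧-mono B cB u⊑u′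
  = ∨-mono-≤ a₀ b₁ , ∧-mono-≤ a₁ b₀

bivalent : Bool → Val
bivalent a = a , not a

bivalent-⊑ : ∀ {a} → NonEmpty a → bivalent (proj₁ a) ⊑ a
bivalent-⊑ only0 = ⊑-refl
bivalent-⊑ both  = b≤b , f≤t
bivalent-⊑ only1 = ⊑-refl

∨v-bivalent : ∀ a b → bivalent a ∨v bivalent b ≡ bivalent (a ∨ b)
∨v-bivalent false _ = refl
∨v-bivalent true  _ = refl

∧v-bivalent : ∀ a b → bivalent a ∧v bivalent b ≡ bivalent (a ∧ b)
∧v-bivalent false _ = refl
∧v-bivalent true  _ = refl

⇒c-bivalent : ∀ a b → bivalent a ⇒c bivalent b ≡ bivalent (not a ∨ b)
⇒c-bivalent false _ = refl
⇒c-bivalent true  _ = refl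

⟦⟧-bivalent : ∀ w A → IsClassical A → ⟦ A ⟧ (bivalent ∘ w) ≡ bivalent (eval2 w A)
⟦⟧-bivalent w (var p)  _         = refl
⟦⟧-bivalent w ⊥f       _         = refl
⟦⟧-bivalent w (A ∨f B) (cA , cB) =
  trans (cong₂ _∨v_ (⟦⟧-bivalent w A cA) (⟦⟧-bivalent w B cB))
        (∨v-bivalent (eval2 w A) (eval2 w B))
⟦⟧-bivalent w (A ∧f B) (cA , cB) =
  trans (cong₂ _∧v_ (⟦⟧-bivalent w A cA) (⟦⟧-bivalent w B cB))
        (∧v-bivalent (eval2 w A) (eval2 w B))
⟦⟧-bivalent w (A →c B) (cA , cB) =
  trans (cong₂ _⇒c_ (⟦⟧-bivalent w A cA) (⟦⟧-bivalent w B cB))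
        (⇒c-bivalent (eval2 w A) (eval2 w B))

tautology-valid : ∀ σ A → Tautology A → Valid3 (subst σ A)
tautology-valid σ A (cA , taut) v rewrite ev3-subst v σ A =
  T-mono-≤ (proj₁ (⟦⟧-mono A cA (λ p → bivalent-⊑ (ev3-nonEmpty v (σ p))))) classical
  where
  w : ℕ → Bool
  w = proj₁ ∘ ev3 v ∘ σ

  classical : Designated (⟦ A ⟧ (bivalent ∘ w))
  classical rewrite ⟦⟧-bivalent w A cA = taut w

⇒c-refl-designated : ∀ {a} → NonEmpty a → Designated (a ⇒c a)
⇒c-refl-designated only0 = tt
⇒c-refl-designated both  = tt
⇒c-refl-designated only1 = tt

⇒i-refl-designated : ∀ a → Designated (a ⇒i a)
⇒i-refl-designated (false , _) = tt
⇒i-refl-designated (true  , _) = tt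

⇒i-modusPonens : ∀ {a b} → Designated a → Designated (a ⇒i b) → Designated b
⇒i-modusPonens {true , _} _ d = d

⇒i-designated : ∀ a {b} → Designated b → Designated (a ⇒i b)
⇒i-designated (false , _) _ = tt
⇒i-designated (true  , _) d = d

CK-designated : ∀ {a b c} → NonEmpty a → NonEmpty b → NonEmpty c →
                Designated ((a ⇒i (b ⇒c c)) ⇒c ((a ⇒i b) ⇒c (a ⇒i c)))
CK-designated only0 _  _  = tt
CK-designated both  nb nc = ⇒c-refl-designated (∨v-nonEmpty (¬v-nonEmpty nb) nc)
CK-designated only1 nb nc = ⇒c-refl-designated (∨v-nonEmpty (¬v-nonEmpty nb) nc)

CMP-designated : ∀ {a b} → NonEmpty a → NonEmpty b → Designated ((a ⇒i b) ⇒c (a ⇒c b))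
CMP-designated only0 _     = tt
CMP-designated both  only0 = tt
CMP-designated both  both  = tt
CMP-designated both  only1 = tt
CMP-designated only1 nb    = ⇒c-refl-designated nb

PER-designated : ∀ {a} → NonEmpty a → ∀ b → Designated (a ⇒c (b ⇒i a))
PER-designated only0 _           = tt
PER-designated both  _           = tt
PER-designated only1 (false , _) = tt
PER-designated only1 (true  , _) = tt

lemma12 : (A : Form) → Thm A → Valid3 A
lemma12 _ (CL σ A t)        = tautology-valid σ A t
lemma12 _ (CK A B C)        v =
  CK-designated (ev3-nonEmpty v A) (ev3-nonEmpty v B) (ev3-nonEmpty v C)
lemma12 _ (ID A)            v = ⇒i-refl-designated (ev3 v A)
lemma12 _ (CMP A B)         v = CMP-designated (ev3-nonEmpty v A) (ev3-nonEmpty v B)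
lemma12 _ (PER A B _)       v = PER-designated (ev3-nonEmpty v A) (ev3 v B)
lemma12 _ (MPI {A} {B} d e) v =
  ⇒i-modusPonens {ev3 v A} {ev3 v B} (lemma12 _ d v) (lemma12 _ e v)
lemma12 _ (RCN {A} B d)     v = ⇒i-designated (ev3 v B) {ev3 v A} (lemma12 _ d v)
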